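{- Let $L$ be a multiset of even integers greater than $2$. Then there exists an $\alpha$-labeling of $[L\mid m]$ for every $m\ge 2(|L|+1)(\max(L)+1)+3$.
   Context: $\mathcal{I}(a,b)=\{x\in\mathbb{Z}\mid a\le x\le b\}$; $|L|$ counts multiplicity; the maximum of an empty multiset is $0$. $[L\mid m]$ is the vertex-disjoint union of one $\ell$-cycle for each $\ell\in L$ and a path with $m$ edges; its number of edges is $\epsilon=\sum_{\ell\in L}\ell+m$. A labeling is an isomorphic copy with distinct integer vertices; $\Delta\Gamma$ is the multiset of differences $x-y$ over ordered pairs of adjacent vertices. An $\alpha$-labeling of such a bipartite graph with $\epsilon$ edges is a labeling $\Gamma$ with vertex set $\mathcal{I}(0,\epsilon)$ such that every edge joins a vertex of $\mathcal{I}(0,\lfloor(\epsilon-1)/2\rfloor)$ to a vertex of $\mathcal{I}(\lfloor(\epsilon+1)/2\rfloor,\epsilon)$ and $\Delta\Gamma=\pm\mathcal{I}(1,\epsilon)$. -}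

module Defs where

open import Data.Nat as ℕ using (ℕ; zero; suc; _+_; _*_; _∸_; _/_; _⊔_)
open import Data.Nat.Divisibility using (_∣_)
open import Data.Nat.ListAction using (sum)
open import Data.Integer as ℤ using (ℤ; +_; -_; _-_; _≤_)
open import Data.Fin using (Fin; inject₁; fromℕ) renaming (zero to fzero; suc to fsuc)
open import Data.List using (List; []; _∷_; _++_; map; concatMap; length; lookup; foldr; upTo; allFin)
open import Data.List.Membership.Propositional using (_∈_)
open import Data.List.Relation.Binary.Permutation.Propositional using (_↭_)
open import Data.Product using (_×_; _,_; ∃)
open import Data.Sum using (_⊎_)
open import Function.Definitions using (Injective)
open import Relation.Binary.PropositionalEquality using (_≡_)

-- |L| is  length L ;  max(L) (0 for the empty multiset):
maxL : List ℕ → ℕ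
maxL = foldr _⊔_ 0

edgeCount : List ℕ → ℕ → ℕ
edgeCount L m = sum L + m

-- vertices of the abstract graph [L | m]:
-- vertex j of the i-th cycle (of length lookup L i), or vertex k of the path (m+1 vertices)
data Vertex (L : List ℕ) (m : ℕ) : Set where
  cyc : (i : Fin (length L)) → Fin (lookup L i) → Vertex L m
  pth : Fin (suc m) → Vertex L m

cycleEdges : (ℓ : ℕ) → List (Fin ℓ × Fin ℓ)
cycleEdges zero = []
cycleEdges (suc k) = map (λ j → inject₁ j , fsuc j) (allFin k) ++ ((fromℕ k , fzero) ∷ [])

pathEdges : (m : ℕ) → List (Fin (suc m) × Fin (suc m))
pathEdges m = map (λ j → inject₁ j , fsuc j) (allFin m)

-- edge list (each edge listed once) of [L | m]
edges : (L : List ℕ) (m : ℕ) → List (Vertex L m × Vertex L m)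
edges L m =
  concatMap (λ i → map (λ { (a , b) → cyc i a , cyc i b }) (cycleEdges (lookup L i))) (allFin (length L))
  ++ map (λ { (a , b) → pth a , pth b }) (pathEdges m)

inI : ℤ → ℤ → ℤ → Set
inI a b x = a ≤ x × x ≤ b

ΔΓ : {L : List ℕ} {m : ℕ} → (Vertex L m → ℤ) → List (Vertex L m × Vertex L m) → List ℤ
ΔΓ f = concatMap (λ { (u , v) → (f u - f v) ∷ (f v - f u) ∷ [] })

pmI : ℕ → List ℤ
pmI ε = map (λ k → + suc k) (upTo ε) ++ map (λ k → - (+ suc k)) (upTo ε)

-- α-labeling of [L | m] (with ε = edgeCount L m edges): an injective integer labeling f
-- of the vertices (an isomorphic copy Γ with distinct integer vertices) whose vertex set is I(0,ε),
-- every edge joins I(0,⌊(ε-1)/2⌋) to I(⌊(ε+1)/2⌋,ε), and ΔΓ = ±I(1,ε) as multisets.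
record IsAlphaLabeling (L : List ℕ) (m : ℕ) (f : Vertex L m → ℤ) : Set where
  field
    injective : Injective _≡_ _≡_ f
    vertexSet : ∀ x → (inI (+ 0) (+ edgeCount L m) x → ∃ λ v → f v ≡ x)
                    × (∀ v → f v ≡ x → inI (+ 0) (+ edgeCount L m) x)
    bipartition : ∀ {u v} → (u , v) ∈ edges L m →
      let ε = edgeCount L m
          low  = inI (+ 0) (+ ((ε ∸ 1) / 2))
          high = inI (+ ((ε + 1) / 2)) (+ ε)
      in (low (f u) × high (f v)) ⊎ (low (f v) × high (f u))
    differences : ΔΓ f (edges L m) ↭ pmI (edgeCount L m)

module Submission where

-- The labelling is built from the inside out.  Around an α-labelling with ε edges whose path starts
-- at label ε − 1 one puts a collar with 2n new vertices: the old labels move up by n, the new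
-- vertices take the n smallest labels i and the n largest labels ε + 2n − j, every new edge joins a
-- small to a large label, and the new gaps ε + 1, …, ε + 2n come from index sums i + j = 2n − 1, …, 0.
-- A collar consisting of one ℓ-cycle (ℓ even, ℓ > 2) and a path with fewer than ℓ edges exists for
-- ℓ = 4, 6 and can be grown by four; a collar that is just a path of four edges lengthens the path.
-- Starting from α-labelled paths with 5, …, 8 edges, one collar per cycle adds at most
-- ∑ L ≤ |L| · max L path edges, which the bound on m accommodates.

open import Defs
import Algebra.Solver.CommutativeMonoid as CommutativeMonoidSolver
open import Data.Bool using (T)
open import Data.Empty using (⊥; ⊥-elim)
open import Data.Fin using (Fin; inject₁; fromℕ) renaming (zero to fzero; suc to fsuc)
open import Data.Integer as ℤ using (ℤ)
import Data.Integer.Properties as ℤₚ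
open import Data.List using (List; []; _∷_; _++_; [_]; _∷ʳ_; map; concat; concatMap; length; lookup; upTo; applyUpTo; allFin)
import Data.List.Properties as Listₚ
open import Data.List.Membership.Propositional using (_∈_)
import Data.List.Membership.Propositional.Properties as ∈ₚ
open import Data.List.Relation.Binary.Permutation.Propositional
  using (_↭_; ↭-refl; ↭-sym; ↭-trans; ↭-prep; ↭-swap; ↭-reflexive; ↭⇒↭ₛ; module PermutationReasoning)
import Data.List.Relation.Binary.Permutation.Propositional.Properties as ↭ₚ
import Data.List.Relation.Binary.Permutation.Setoid.Properties as ↭ₛₚ
open import Data.List.Relation.Binary.Pointwise as Pointwise using (Pointwise; []; _∷_)
open import Data.List.Relation.Unary.All as All using (All; []; _∷_)
import Data.List.Relation.Unary.All.Properties as Allₚ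
open import Data.List.Relation.Unary.AllPairs using (_∷_)
open import Data.List.Relation.Unary.Any using (here; there)
open import Data.List.Relation.Unary.Unique.Propositional using (Unique)
import Data.List.Relation.Unary.Unique.Propositional.Properties as Uniqueₚ
open import Data.Maybe using (Maybe; just; nothing; is-just; to-witness-T)
open import Data.Nat as ℕ using (ℕ; zero; suc; _+_; _*_; _∸_; _/_; _≤_; _<_; z≤n; s≤s; ∣_-_∣)
import Data.Nat.DivMod as ℕ
open import Data.Nat.Divisibility using (_∣_; _∣?_; ∣m+n∣m⇒∣n; divides)
open import Data.Nat.ListAction using (sum)
import Data.Nat.ListAction.Properties as sumₚ
import Data.Nat.Properties as ℕₚ
open import Data.Nat.Tactic.RingSolver using (solve-∀)
open import Data.Product using (_×_; _,_; Σ; ∃)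
open import Data.Sum using (_⊎_; inj₁; inj₂)
open import Data.Unit using (tt)
open import Function using (_∘_; id)
open import Function.Definitions using (Injective)
open import Relation.Binary.Definitions using (DecidableEquality)
open import Relation.Binary.PropositionalEquality using (_≡_; refl; sym; trans; cong; cong₂; subst; module ≡-Reasoning)
open import Relation.Binary.PropositionalEquality.Properties using (setoid)
open import Relation.Nullary using (Dec; yes; no)
open import Relation.Nullary.Decidable using (True; toWitness; toWitnessFalse; _×-dec_; _⊎-dec_)

module PermutationSearch {A : Set} (_≟_ : DecidableEquality A) where

  extract : (x : A) (ys : List A) → Maybe (∃ λ zs → ys ↭ x ∷ zs)
  extract x [] = nothing
  extract x (y ∷ ys) with x ≟ y | extract x ys
  ... | yes refl | _ = just (ys , ↭-refl)
  ... | no _ | nothing = nothing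
  ... | no _ | just (zs , p) = just (y ∷ zs , ↭-trans (↭-prep y p) (↭-swap y x ↭-refl))

  permutation? : (xs ys : List A) → Maybe (xs ↭ ys)
  permutation? [] [] = just ↭-refl
  permutation? [] (_ ∷ _) = nothing
  permutation? (x ∷ xs) ys with extract x ys
  ... | nothing = nothing
  ... | just (zs , p) with permutation? xs zs
  ...   | nothing = nothing
  ...   | just q = just (↭-trans (↭-prep x q) (↭-sym p))

module ℕ-Permutation = PermutationSearch ℕ._≟_

both : {A B : Set} → (A → B) → A × A → B × B
both f (x , y) = f x , f y

pathPairs : {A : Set} → List A → List (A × A)
pathPairs [] = []
pathPairs (x ∷ []) = []
pathPairs (x ∷ y ∷ xs) = (x , y) ∷ pathPairs (y ∷ xs)

cyclePairs : {A : Set} → List A → List (A × A)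
cyclePairs [] = []
cyclePairs (x ∷ xs) = pathPairs (x ∷ xs ∷ʳ x)

pathPairs-map : {A B : Set} (f : A → B) (xs : List A) → pathPairs (map f xs) ≡ map (both f) (pathPairs xs)
pathPairs-map f [] = refl
pathPairs-map f (x ∷ []) = refl
pathPairs-map f (x ∷ y ∷ xs) = cong ((f x , f y) ∷_) (pathPairs-map f (y ∷ xs))

cyclePairs-map : {A B : Set} (f : A → B) (xs : List A) → cyclePairs (map f xs) ≡ map (both f) (cyclePairs xs)
cyclePairs-map f [] = refl
cyclePairs-map f (x ∷ xs) =
  trans (cong (λ ys → pathPairs (f x ∷ ys)) (sym (Listₚ.map-++ f xs [ x ]))) (pathPairs-map f (x ∷ xs ∷ʳ x))

concatMap-cyclePairs-map : {A B : Set} (f : A → B) (xss : List (List A)) →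
  concatMap cyclePairs (map (map f) xss) ≡ map (both f) (concatMap cyclePairs xss)
concatMap-cyclePairs-map f [] = refl
concatMap-cyclePairs-map f (xs ∷ xss) =
  trans (cong₂ _++_ (cyclePairs-map f xs) (concatMap-cyclePairs-map f xss))
        (sym (Listₚ.map-++ (both f) (cyclePairs xs) (concatMap cyclePairs xss)))

pathPairs-++ : {A : Set} (xs : List A) (y : A) (ys : List A) →
  pathPairs (xs ++ y ∷ ys) ≡ pathPairs (xs ∷ʳ y) ++ pathPairs (y ∷ ys)
pathPairs-++ [] y ys = refl
pathPairs-++ (x ∷ []) y ys = refl
pathPairs-++ (x ∷ x′ ∷ xs) y ys = cong ((x , x′) ∷_) (pathPairs-++ (x′ ∷ xs) y ys)

++-interchange : {A : Set} (ws xs ys zs : List A) → (ws ++ xs) ++ (ys ++ zs) ↭ (ws ++ ys) ++ (xs ++ zs)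
++-interchange ws xs ys zs = ↭-trans (↭-reflexive (Listₚ.++-assoc ws xs (ys ++ zs)))
  (↭-trans (↭ₚ.++⁺ˡ ws (↭ₚ.shifts xs ys)) (↭-reflexive (sym (Listₚ.++-assoc ws ys (xs ++ zs)))))

concatMap⁺ : {A B : Set} {f g : A → List B} → (∀ x → f x ↭ g x) → ∀ xs → concatMap f xs ↭ concatMap g xs
concatMap⁺ f↭g [] = ↭-refl
concatMap⁺ f↭g (x ∷ xs) = ↭ₚ.++⁺ (f↭g x) (concatMap⁺ f↭g xs)

concatMap-pair-↭ : {A B : Set} (f g : A → B) (xs : List A) →
  concatMap (λ x → f x ∷ g x ∷ []) xs ↭ map f xs ++ map g xs
concatMap-pair-↭ f g [] = ↭-refl
concatMap-pair-↭ f g (x ∷ xs) = ↭-prep (f x)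
  (↭-trans (↭-prep (g x) (concatMap-pair-↭ f g xs)) (↭-sym (↭ₚ.shift (g x) (map f xs) (map g xs))))

upTo-+ : ∀ m n → upTo (m + n) ≡ upTo m ++ map (m +_) (upTo n)
upTo-+ zero n = sym (Listₚ.map-id (upTo n))
upTo-+ (suc m) n = cong (0 ∷_) (begin
    applyUpTo suc (m + n)
  ≡⟨ Listₚ.map-upTo suc (m + n) ⟨
    map suc (upTo (m + n))
  ≡⟨ cong (map suc) (upTo-+ m n) ⟩
    map suc (upTo m ++ map (m +_) (upTo n))
  ≡⟨ Listₚ.map-++ suc (upTo m) _ ⟩
    map suc (upTo m) ++ map suc (map (m +_) (upTo n))
  ≡⟨ cong₂ _++_ (Listₚ.map-upTo suc m) (sym (Listₚ.map-∘ (upTo n))) ⟩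
    applyUpTo suc m ++ map (suc m +_) (upTo n) ∎)
  where open ≡-Reasoning

reflect-upTo-↭ : ∀ n → map (λ j → n ∸ suc j) (upTo n) ↭ upTo n
reflect-upTo-↭ zero = ↭-refl
reflect-upTo-↭ (suc n) = begin
    n ∷ map (λ j → suc n ∸ suc j) (applyUpTo suc n)
  ≡⟨ cong (λ js → n ∷ map (λ j → suc n ∸ suc j) js) (Listₚ.map-upTo suc n) ⟨
    n ∷ map (λ j → suc n ∸ suc j) (map suc (upTo n))
  ≡⟨ cong (n ∷_) (Listₚ.map-∘ (upTo n)) ⟨
    n ∷ map (λ j → n ∸ suc j) (upTo n)
  ↭⟨ ↭-prep n (reflect-upTo-↭ n) ⟩
    n ∷ upTo n
  ↭⟨ ↭ₚ.∷↭∷ʳ n (upTo n) ⟩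
    upTo n ∷ʳ n
  ≡⟨ Listₚ.upTo-∷ʳ n ⟩
    upTo (suc n) ∎
  where open PermutationReasoning

+-∸-complement : ∀ {t n} c → t < n → (n + c) ∸ t ≡ suc c + (n ∸ suc t)
+-∸-complement {t} {n} c t<n = begin
    (n + c) ∸ t
  ≡⟨ cong (λ k → (k + c) ∸ t) (ℕₚ.m+[n∸m]≡n t<n) ⟨
    (suc t + (n ∸ suc t) + c) ∸ t
  ≡⟨ cong (_∸ t) (rearrange t (n ∸ suc t) c) ⟩
    (t + (suc c + (n ∸ suc t))) ∸ t
  ≡⟨ ℕₚ.m+n∸m≡n t _ ⟩
    suc c + (n ∸ suc t) ∎
  where
    open ≡-Reasoning
    rearrange : ∀ t r c → suc t + r + c ≡ t + (suc c + r)
    rearrange = solve-∀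

∸-upTo-↭ : ∀ n c → map ((n + c) ∸_) (upTo n) ↭ map (suc c +_) (upTo n)
∸-upTo-↭ n c = begin
    map ((n + c) ∸_) (upTo n)
  ≡⟨ Listₚ.map-cong-local (All.tabulate (+-∸-complement c ∘ ∈ₚ.∈-upTo⁻)) ⟩
    map (λ t → suc c + (n ∸ suc t)) (upTo n)
  ≡⟨ Listₚ.map-∘ (upTo n) ⟩
    map (suc c +_) (map (λ t → n ∸ suc t) (upTo n))
  ↭⟨ ↭ₚ.map⁺ (suc c +_) (reflect-upTo-↭ n) ⟩
    map (suc c +_) (upTo n) ∎
  where open PermutationReasoning

-- α-labellings given by label lists

gap : ℕ × ℕ → ℕ
gap (x , y) = ∣ x - y ∣

Straddles : ℕ → ℕ × ℕ → Set
Straddles a (x , y) = (x < a × a ≤ y) ⊎ (y < a × a ≤ x)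

graphPairs : List (List ℕ) → List ℕ → List (ℕ × ℕ)
graphPairs cycles path = concatMap cyclePairs cycles ++ pathPairs path

-- An α-labelling of cycles and a path given by the label sequences along them.  The path is
-- required to start at label ε − 1: this is the vertex to which a collar attaches below.
record AlphaLists (ε : ℕ) (cycles : List (List ℕ)) (tail : List ℕ) : Set where
  field
    labels   : concat cycles ++ (ε ∸ 1) ∷ tail ↭ upTo (suc ε)
    straddle : All (Straddles (suc ε / 2)) (graphPairs cycles ((ε ∸ 1) ∷ tail))
    gaps     : map gap (graphPairs cycles ((ε ∸ 1) ∷ tail)) ↭ map suc (upTo ε)
    2≤ε      : 2 ≤ ε

CycleLengths : List (List ℕ) → List ℕ → Set
CycleLengths = Pointwise (λ c ℓ → length c ≡ ℓ)

record Alpha (L : List ℕ) (m : ℕ) : Set where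
  field
    cycles        : List (List ℕ)
    cycle-lengths : CycleLengths cycles L
    tail          : List ℕ
    tail-length   : length tail ≡ m
    lists         : AlphaLists (edgeCount L m) cycles tail

map-allFin-suc : {A : Set} (n : ℕ) (f : Fin (suc n) → A) → map f (allFin (suc n)) ≡ f fzero ∷ map (f ∘ fsuc) (allFin n)
map-allFin-suc n f = cong (f fzero ∷_) (trans (Listₚ.map-tabulate fsuc f) (sym (Listₚ.map-tabulate id (f ∘ fsuc))))

concatMap-allFin-suc : {A : Set} (n : ℕ) (f : Fin (suc n) → List A) →
  concatMap f (allFin (suc n)) ≡ f fzero ++ concatMap (f ∘ fsuc) (allFin n)
concatMap-allFin-suc n f = cong concat (map-allFin-suc n f)

lookup-pathPairs : {A : Set} (x : A) (xs : List A) →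
  map (λ j → lookup (x ∷ xs) (inject₁ j) , lookup (x ∷ xs) (fsuc j)) (allFin (length xs)) ≡ pathPairs (x ∷ xs)
lookup-pathPairs x [] = refl
lookup-pathPairs x (y ∷ ys) = trans (map-allFin-suc (length ys) _) (cong ((x , y) ∷_) (lookup-pathPairs y ys))

lookup-pathPairs-∷ʳ : {A : Set} (x z : A) (xs : List A) →
  map (λ j → lookup (x ∷ xs) (inject₁ j) , lookup (x ∷ xs) (fsuc j)) (allFin (length xs))
    ∷ʳ (lookup (x ∷ xs) (fromℕ (length xs)) , z) ≡ pathPairs (x ∷ xs ∷ʳ z)
lookup-pathPairs-∷ʳ x z [] = refl
lookup-pathPairs-∷ʳ x z (y ∷ ys) =
  trans (cong (_∷ʳ (lookup (x ∷ y ∷ ys) (fromℕ (suc (length ys))) , z)) (map-allFin-suc (length ys) _))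
        (cong ((x , y) ∷_) (lookup-pathPairs-∷ʳ y z ys))

lookupAt : {A : Set} (xs : List A) {n : ℕ} → length xs ≡ n → Fin n → A
lookupAt xs refl = lookup xs

map-lookupAt-allFin : {A : Set} (xs : List A) {n : ℕ} (e : length xs ≡ n) → map (lookupAt xs e) (allFin n) ≡ xs
map-lookupAt-allFin xs refl = trans (Listₚ.map-tabulate id (lookup xs)) (Listₚ.tabulate-lookup xs)

map-lookupAt-cycleEdges : {A : Set} (xs : List A) {n : ℕ} (e : length xs ≡ n) →
  map (both (lookupAt xs e)) (cycleEdges n) ≡ cyclePairs xs
map-lookupAt-cycleEdges [] refl = refl
map-lookupAt-cycleEdges {A} (x ∷ xs) refl = begin
    map (both f) (map (λ j → inject₁ j , fsuc j) (allFin k) ∷ʳ (fromℕ k , fzero))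
  ≡⟨ Listₚ.map-++ (both f) (map (λ j → inject₁ j , fsuc j) (allFin k)) _ ⟩
    map (both f) (map (λ j → inject₁ j , fsuc j) (allFin k)) ∷ʳ (f (fromℕ k) , x)
  ≡⟨ cong (_∷ʳ (f (fromℕ k) , x)) (Listₚ.map-∘ (allFin k)) ⟨
    map (λ j → f (inject₁ j) , f (fsuc j)) (allFin k) ∷ʳ (f (fromℕ k) , x)
  ≡⟨ lookup-pathPairs-∷ʳ x x xs ⟩
    pathPairs (x ∷ xs ∷ʳ x) ∎
  where
    open ≡-Reasoning
    k : ℕ
    k = length xs
    f : Fin (suc k) → A
    f = lookup (x ∷ xs)

map-lookupAt-pathEdges : {A : Set} (xs : List A) {m : ℕ} (e : length xs ≡ suc m) →
  map (both (lookupAt xs e)) (pathEdges m) ≡ pathPairs xs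
map-lookupAt-pathEdges (x ∷ xs) refl = trans (sym (Listₚ.map-∘ (allFin (length xs)))) (lookup-pathPairs x xs)

cycleLabel : ∀ {cycles L} → CycleLengths cycles L → (i : Fin (length L)) → Fin (lookup L i) → ℕ
cycleLabel (_∷_ {x = c} e _) fzero = lookupAt c e
cycleLabel (_ ∷ es) (fsuc i) = cycleLabel es i

cycleLabel-vertices : ∀ {cycles L} (es : CycleLengths cycles L) →
  concatMap (λ i → map (cycleLabel es i) (allFin (lookup L i))) (allFin (length L)) ≡ concat cycles
cycleLabel-vertices [] = refl
cycleLabel-vertices {c ∷ _} {_ ∷ L} (e ∷ es) =
  trans (concatMap-allFin-suc (length L) _) (cong₂ _++_ (map-lookupAt-allFin c e) (cycleLabel-vertices es))

cycleLabel-edges : ∀ {cycles L} (es : CycleLengths cycles L) →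
  concatMap (λ i → map (both (cycleLabel es i)) (cycleEdges (lookup L i))) (allFin (length L)) ≡ concatMap cyclePairs cycles
cycleLabel-edges [] = refl
cycleLabel-edges {c ∷ _} {_ ∷ L} (e ∷ es) =
  trans (concatMap-allFin-suc (length L) _) (cong₂ _++_ (map-lookupAt-cycleEdges c e) (cycleLabel-edges es))

module _ {L : List ℕ} {m : ℕ} where

  vertices : List (Vertex L m)
  vertices = concatMap (λ i → map (cyc i) (allFin (lookup L i))) (allFin (length L)) ++ map pth (allFin (suc m))

  ∈-vertices : ∀ v → v ∈ vertices
  ∈-vertices (cyc i j) = ∈ₚ.∈-++⁺ˡ (∈ₚ.∈-concat⁺′ (∈ₚ.∈-map⁺ (cyc i) (∈ₚ.∈-allFin j)) (∈ₚ.∈-map⁺ _ (∈ₚ.∈-allFin i)))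
  ∈-vertices (pth k) = ∈ₚ.∈-++⁺ʳ _ (∈ₚ.∈-map⁺ pth (∈ₚ.∈-allFin k))

  module _ (g : (i : Fin (length L)) → Fin (lookup L i) → ℕ) (h : Fin (suc m) → ℕ) where

    vertexLabel : Vertex L m → ℕ
    vertexLabel (cyc i j) = g i j
    vertexLabel (pth k) = h k

    map-vertexLabel-vertices : map vertexLabel vertices
      ≡ concatMap (λ i → map (g i) (allFin (lookup L i))) (allFin (length L)) ++ map h (allFin (suc m))
    map-vertexLabel-vertices = trans (Listₚ.map-++ vertexLabel _ (map pth (allFin (suc m))))
      (cong₂ _++_ (trans (Listₚ.map-concatMap vertexLabel _ (allFin (length L)))
                         (Listₚ.concatMap-cong (λ i → sym (Listₚ.map-∘ (allFin (lookup L i)))) (allFin (length L))))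
                  (sym (Listₚ.map-∘ (allFin (suc m)))))

    map-vertexLabel-edges : map (both vertexLabel) (edges L m)
      ≡ concatMap (λ i → map (both (g i)) (cycleEdges (lookup L i))) (allFin (length L)) ++ map (both h) (pathEdges m)
    map-vertexLabel-edges = trans (Listₚ.map-++ (both vertexLabel) _ (map _ (pathEdges m)))
      (cong₂ _++_ (trans (Listₚ.map-concatMap (both vertexLabel) _ (allFin (length L)))
                         (Listₚ.concatMap-cong (λ i → sym (Listₚ.map-∘ (cycleEdges (lookup L i)))) (allFin (length L))))
                  (sym (Listₚ.map-∘ (pathEdges m))))

map-Unique⇒injectiveOn : {A B : Set} (f : A → B) {xs : List A} → Unique (map f xs) →
  ∀ {u v} → u ∈ xs → v ∈ xs → f u ≡ f v → u ≡ v
map-Unique⇒injectiveOn f {x ∷ xs} _ (here refl) (here refl) _ = refl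
map-Unique⇒injectiveOn f {x ∷ xs} (x∉ ∷ _) (here refl) (there v∈) fu≡fv = ⊥-elim (All.lookup x∉ (∈ₚ.∈-map⁺ f v∈) fu≡fv)
map-Unique⇒injectiveOn f {x ∷ xs} (x∉ ∷ _) (there u∈) (here refl) fu≡fv = ⊥-elim (All.lookup x∉ (∈ₚ.∈-map⁺ f u∈) (sym fu≡fv))
map-Unique⇒injectiveOn f {x ∷ xs} (_ ∷ u) (there u∈) (there v∈) fu≡fv = map-Unique⇒injectiveOn f u u∈ v∈ fu≡fv

module Enumeration {A : Set} (f : A → ℕ) {xs : List A} (complete : ∀ x → x ∈ xs) {n : ℕ} (perm : map f xs ↭ upTo n) where

  injective : Injective _≡_ _≡_ f
  injective {u} {v} = map-Unique⇒injectiveOn f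
    (↭ₛₚ.Unique-resp-↭ (setoid ℕ) (↭⇒↭ₛ (↭-sym perm)) (Uniqueₚ.upTo⁺ n)) (complete u) (complete v)

  bounded : ∀ x → f x < n
  bounded x = ∈ₚ.∈-upTo⁻ (↭ₚ.∈-resp-↭ perm (∈ₚ.∈-map⁺ f (complete x)))

  surjective : ∀ {k} → k < n → ∃ λ x → f x ≡ k
  surjective k<n with ∈ₚ.∈-map⁻ f (↭ₚ.∈-resp-↭ (↭-sym perm) (∈ₚ.∈-upTo⁺ k<n))
  ... | x , _ , k≡fx = x , sym k≡fx

suc-suc-/2 : ∀ n → suc (suc n) / 2 ≡ suc (n / 2)
suc-suc-/2 n = ℕ.m/n≡1+[m∸n]/n {suc (suc n)} {2} (s≤s (s≤s z≤n))

<-⌈/2⌉⇒≤-⌊pred/2⌋ : ∀ {x} ε → x < suc ε / 2 → x ≤ (ε ∸ 1) / 2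
<-⌈/2⌉⇒≤-⌊pred/2⌋ {x} (suc ε) x< = ℕₚ.≤-pred (subst (x <_) (suc-suc-/2 ε) x<)

signedGaps : ℕ × ℕ → List ℤ
signedGaps (x , y) = ℤ.+ x ℤ.- ℤ.+ y ∷ ℤ.+ y ℤ.- ℤ.+ x ∷ []

signedGaps-≥ : ∀ {x y} → y ≤ x → signedGaps (x , y) ≡ ℤ.+ gap (x , y) ∷ ℤ.- ℤ.+ gap (x , y) ∷ []
signedGaps-≥ {x} {y} y≤x = cong₂ (λ a b → a ∷ b ∷ [])
  (trans (ℤₚ.m-n≡m⊖n x y) (trans (ℤₚ.⊖-≥ y≤x) (cong ℤ.+_ (sym gap≡))))
  (trans (ℤₚ.m-n≡m⊖n y x) (trans (ℤₚ.⊖-≤ y≤x) (cong (ℤ.-_ ∘ ℤ.+_) (sym gap≡))))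
  where
    gap≡ : ∣ x - y ∣ ≡ x ∸ y
    gap≡ = ℕₚ.m≤n⇒∣n-m∣≡n∸m y≤x

signedGaps-↭ : ∀ p → signedGaps p ↭ ℤ.+ gap p ∷ ℤ.- ℤ.+ gap p ∷ []
signedGaps-↭ (x , y) with ℕₚ.≤-total y x
... | inj₁ y≤x = ↭-reflexive (signedGaps-≥ y≤x)
... | inj₂ x≤y = ↭-trans (↭-swap _ _ ↭-refl)
  (↭-reflexive (trans (signedGaps-≥ x≤y) (cong (λ d → ℤ.+ d ∷ ℤ.- ℤ.+ d ∷ []) (ℕₚ.∣-∣-comm y x))))

concatMap-signedGaps-↭ : ∀ ε ps → map gap ps ↭ map suc (upTo ε) → concatMap signedGaps ps ↭ pmI ε
concatMap-signedGaps-↭ ε ps gaps = begin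
    concatMap signedGaps ps
  ↭⟨ concatMap⁺ signedGaps-↭ ps ⟩
    concatMap ((λ d → ℤ.+ d ∷ ℤ.- ℤ.+ d ∷ []) ∘ gap) ps
  ≡⟨ Listₚ.concatMap-map (λ d → ℤ.+ d ∷ ℤ.- ℤ.+ d ∷ []) gap ps ⟨
    concatMap (λ d → ℤ.+ d ∷ ℤ.- ℤ.+ d ∷ []) (map gap ps)
  ↭⟨ concatMap-pair-↭ ℤ.+_ (ℤ.-_ ∘ ℤ.+_) (map gap ps) ⟩
    map ℤ.+_ (map gap ps) ++ map (ℤ.-_ ∘ ℤ.+_) (map gap ps)
  ↭⟨ ↭ₚ.++⁺ (↭ₚ.map⁺ ℤ.+_ gaps) (↭ₚ.map⁺ (ℤ.-_ ∘ ℤ.+_) gaps) ⟩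
    map ℤ.+_ (map suc (upTo ε)) ++ map (ℤ.-_ ∘ ℤ.+_) (map suc (upTo ε))
  ≡⟨ cong₂ _++_ (Listₚ.map-∘ (upTo ε)) (Listₚ.map-∘ (upTo ε)) ⟨
    pmI ε ∎
  where open PermutationReasoning

isAlphaLabeling : ∀ {L m} → Alpha L m → Σ (Vertex L m → ℤ) (IsAlphaLabeling L m)
isAlphaLabeling {L} {m} α = f , record
  { injective   = injective ∘ ℤₚ.+-injective
  ; vertexSet   = λ x → covers x , within x
  ; bipartition = bipartition
  ; differences = differences
  }
  where
    open Alpha α
    open AlphaLists lists
    ε : ℕ
    ε = edgeCount L m
    path : List ℕ
    path = (ε ∸ 1) ∷ tail
    pathLabel : Fin (suc m) → ℕ
    pathLabel = lookupAt path (cong suc tail-length)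
    label : Vertex L m → ℕ
    label = vertexLabel (cycleLabel cycle-lengths) pathLabel
    f : Vertex L m → ℤ
    f = ℤ.+_ ∘ label

    label-vertices : map label vertices ↭ upTo (suc ε)
    label-vertices = ↭-trans (↭-reflexive (trans (map-vertexLabel-vertices (cycleLabel cycle-lengths) pathLabel)
      (cong₂ _++_ (cycleLabel-vertices cycle-lengths) (map-lookupAt-allFin path (cong suc tail-length))))) labels

    label-edges : map (both label) (edges L m) ≡ graphPairs cycles path
    label-edges = trans (map-vertexLabel-edges (cycleLabel cycle-lengths) pathLabel)
      (cong₂ _++_ (cycleLabel-edges cycle-lengths) (map-lookupAt-pathEdges path (cong suc tail-length)))

    open Enumeration label ∈-vertices label-vertices

    covers : ∀ x → inI (ℤ.+ 0) (ℤ.+ ε) x → ∃ λ v → f v ≡ x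
    covers (ℤ.+ k) (_ , ℤ.+≤+ k≤ε) with surjective (s≤s k≤ε)
    ... | v , refl = v , refl

    within : ∀ x v → f v ≡ x → inI (ℤ.+ 0) (ℤ.+ ε) x
    within _ v refl = ℤ.+≤+ z≤n , ℤ.+≤+ (ℕₚ.≤-pred (bounded v))

    low : ∀ {x} → x < suc ε / 2 → inI (ℤ.+ 0) (ℤ.+ ((ε ∸ 1) / 2)) (ℤ.+ x)
    low x< = ℤ.+≤+ z≤n , ℤ.+≤+ (<-⌈/2⌉⇒≤-⌊pred/2⌋ ε x<)

    high : ∀ v → suc ε / 2 ≤ label v → inI (ℤ.+ ((ε + 1) / 2)) (ℤ.+ ε) (f v)
    high v ≤x = ℤ.+≤+ (subst (λ k → k / 2 ≤ label v) (ℕₚ.+-comm 1 ε) ≤x) , ℤ.+≤+ (ℕₚ.≤-pred (bounded v))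

    Low High : ℤ → Set
    Low = inI (ℤ.+ 0) (ℤ.+ ((ε ∸ 1) / 2))
    High = inI (ℤ.+ ((ε + 1) / 2)) (ℤ.+ ε)

    bipartition : ∀ {u v} → (u , v) ∈ edges L m → (Low (f u) × High (f v)) ⊎ (Low (f v) × High (f u))
    bipartition {u} {v} uv with All.lookup straddle (subst ((label u , label v) ∈_) label-edges (∈ₚ.∈-map⁺ (both label) uv))
    ... | inj₁ (u< , ≤v) = inj₁ (low u< , high v ≤v)
    ... | inj₂ (v< , ≤u) = inj₂ (low v< , high u ≤u)

    differences : ΔΓ f (edges L m) ↭ pmI ε
    differences = ↭-trans
      (↭-reflexive (trans (sym (Listₚ.concatMap-map signedGaps (both label) (edges L m))) (cong (concatMap signedGaps) label-edges)))
      (concatMap-signedGaps-↭ ε _ gaps)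

-- Collars

data Slot : Set where
  lo hi : ℕ → Slot

_≟ₛ_ : DecidableEquality Slot
lo i ≟ₛ lo j with i ℕ.≟ j
... | yes refl = yes refl
... | no i≢j = no λ { refl → i≢j refl }
lo i ≟ₛ hi j = no λ ()
hi i ≟ₛ lo j = no λ ()
hi i ≟ₛ hi j with i ℕ.≟ j
... | yes refl = yes refl
... | no i≢j = no λ { refl → i≢j refl }

module Slot-Permutation = PermutationSearch _≟ₛ_

index : Slot → ℕ
index (lo i) = i
index (hi j) = j

indexSum : Slot × Slot → ℕ
indexSum (x , y) = index x + index y

Crosses : ℕ → Slot × Slot → Set
Crosses n (lo i , hi j) = i < n × j ≤ suc n
Crosses n (hi j , lo i) = i < n × j ≤ suc n
Crosses n (lo _ , lo _) = ⊥
Crosses n (hi _ , hi _) = ⊥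

slotLabel : ℕ → Slot → ℕ
slotLabel E (lo i) = i
slotLabel E (hi j) = E ∸ j

collarPairs : ℕ → List (List Slot) → List Slot → List (Slot × Slot)
collarPairs n cycles tail = concatMap cyclePairs cycles ++ pathPairs (hi 1 ∷ tail ∷ʳ hi (suc n))

-- Cycles and a path hi 1, …, hi (n + 1) through the 2n slots lo 0 … lo (n − 1), hi 0 … hi (n − 1),
-- where the endpoint hi (n + 1) is not a slot of the collar: it is glued to the start of the path
-- of the labelling the collar is put around.  Labelling lo i by i and hi j by E − j, where E is
-- the new number of edges, an edge with index sum s gets the gap E − s.
record Collar : Set where
  field
    size      : ℕ
    cycles    : List (List Slot)
    tail      : List Slot
    slots     : concat cycles ++ hi 1 ∷ tail ↭ map lo (upTo size) ++ map hi (upTo size)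
    crossing  : All (Crosses size) (collarPairs size cycles tail)
    indexSums : map indexSum (collarPairs size cycles tail) ↭ upTo (size + size)

half-+ : ∀ n k → (n + n + k) / 2 ≡ n + k / 2
half-+ zero k = refl
half-+ (suc n) k = begin
    suc (n + suc n + k) / 2  ≡⟨ cong (λ t → suc (t + k) / 2) (ℕₚ.+-suc n n) ⟩
    suc (suc (n + n + k)) / 2 ≡⟨ suc-suc-/2 (n + n + k) ⟩
    suc ((n + n + k) / 2)    ≡⟨ cong suc (half-+ n k) ⟩
    suc (n + k / 2)          ∎
  where open ≡-Reasoning

⌈/2⌉≤pred : ∀ ε → 2 ≤ ε → suc ε / 2 ≤ ε ∸ 1
⌈/2⌉≤pred (suc zero) (s≤s ())
⌈/2⌉≤pred (suc (suc e)) _ =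
  subst (_≤ suc e) (sym (suc-suc-/2 (suc e))) (s≤s (ℕₚ.≤-pred (ℕ.m/n<m (suc e) 2 (s≤s (s≤s z≤n)))))

+-+-∸-suc : ∀ n ε → 1 ≤ ε → (n + n + ε) ∸ suc n ≡ n + (ε ∸ 1)
+-+-∸-suc n (suc e) _ = trans (cong (_∸ suc n) (rearrange n e)) (ℕₚ.m+n∸m≡n (suc n) (n + e))
  where
    rearrange : ∀ n e → n + n + suc e ≡ suc n + (n + e)
    rearrange = solve-∀

collar-labels-↭ : ∀ n ε → (upTo n ++ map ((n + n + ε) ∸_) (upTo n)) ++ map (n +_) (upTo (suc ε)) ↭ upTo (suc (n + n + ε))
collar-labels-↭ n ε = begin
    (upTo n ++ map ((n + n + ε) ∸_) (upTo n)) ++ map (n +_) (upTo (suc ε))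
  ≡⟨ Listₚ.++-assoc (upTo n) _ _ ⟩
    upTo n ++ (map ((n + n + ε) ∸_) (upTo n) ++ map (n +_) (upTo (suc ε)))
  ↭⟨ ↭ₚ.++⁺ˡ (upTo n) (↭ₚ.++-comm (map ((n + n + ε) ∸_) (upTo n)) _) ⟩
    upTo n ++ (map (n +_) (upTo (suc ε)) ++ map ((n + n + ε) ∸_) (upTo n))
  ≡⟨ cong (λ k → upTo n ++ (map (n +_) (upTo (suc ε)) ++ map (k ∸_) (upTo n))) (ℕₚ.+-assoc n n ε) ⟩
    upTo n ++ (map (n +_) (upTo (suc ε)) ++ map ((n + (n + ε)) ∸_) (upTo n))
  ↭⟨ ↭ₚ.++⁺ˡ (upTo n) (↭ₚ.++⁺ˡ (map (n +_) (upTo (suc ε))) (∸-upTo-↭ n (n + ε))) ⟩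
    upTo n ++ (map (n +_) (upTo (suc ε)) ++ map (suc (n + ε) +_) (upTo n))
  ≡⟨ cong (λ xs → upTo n ++ (map (n +_) (upTo (suc ε)) ++ xs))
          (trans (Listₚ.map-cong (rearrange n ε) (upTo n)) (Listₚ.map-∘ (upTo n))) ⟩
    upTo n ++ (map (n +_) (upTo (suc ε)) ++ map (n +_) (map (suc ε +_) (upTo n)))
  ≡⟨ cong (upTo n ++_) (Listₚ.map-++ (n +_) (upTo (suc ε)) _) ⟨
    upTo n ++ map (n +_) (upTo (suc ε) ++ map (suc ε +_) (upTo n))
  ≡⟨ trans (upTo-+ n (suc ε + n)) (cong (λ xs → upTo n ++ map (n +_) xs) (upTo-+ (suc ε) n)) ⟨
    upTo (n + (suc ε + n))
  ≡⟨ cong upTo (total n ε) ⟩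
    upTo (suc (n + n + ε)) ∎
  where
    open PermutationReasoning
    rearrange : ∀ n ε x → suc (n + ε) + x ≡ n + (suc ε + x)
    rearrange = solve-∀
    total : ∀ n ε → n + (suc ε + n) ≡ suc (n + n + ε)
    total = solve-∀

collar-gaps-↭ : ∀ n ε → map ((n + n + ε) ∸_) (upTo (n + n)) ++ map suc (upTo ε) ↭ map suc (upTo (n + n + ε))
collar-gaps-↭ n ε = begin
    map ((n + n + ε) ∸_) (upTo (n + n)) ++ map suc (upTo ε)
  ↭⟨ ↭ₚ.++⁺ʳ (map suc (upTo ε)) (∸-upTo-↭ (n + n) ε) ⟩
    map (suc ε +_) (upTo (n + n)) ++ map suc (upTo ε)
  ↭⟨ ↭ₚ.++-comm (map (suc ε +_) (upTo (n + n))) (map suc (upTo ε)) ⟩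
    map suc (upTo ε) ++ map (suc ε +_) (upTo (n + n))
  ≡⟨ cong (map suc (upTo ε) ++_) (Listₚ.map-∘ (upTo (n + n))) ⟩
    map suc (upTo ε) ++ map suc (map (ε +_) (upTo (n + n)))
  ≡⟨ trans (cong (map suc) (upTo-+ ε (n + n))) (Listₚ.map-++ suc (upTo ε) _) ⟨
    map suc (upTo (ε + (n + n)))
  ≡⟨ cong (map suc ∘ upTo) (ℕₚ.+-comm ε (n + n)) ⟩
    map suc (upTo (n + n + ε)) ∎
  where open PermutationReasoning

module ExtendByCollar (c : Collar) {ε : ℕ} {cycles : List (List ℕ)} {tail : List ℕ} (α : AlphaLists ε cycles tail) where
  open Collar c renaming (cycles to slotCycles; tail to slotTail)
  open AlphaLists α

  n E : ℕ
  n = size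
  E = n + n + ε

  outer : Slot → ℕ
  outer = slotLabel E

  inner : ℕ → ℕ
  inner = n +_

  path : List ℕ
  path = (ε ∸ 1) ∷ tail

  cycles′ : List (List ℕ)
  cycles′ = map (map outer) slotCycles ++ map (map inner) cycles

  tail′ : List ℕ
  tail′ = map outer slotTail ++ map inner path

  1≤ε : 1 ≤ ε
  1≤ε = ℕₚ.≤-trans (s≤s z≤n) 2≤ε

  labels′ : concat cycles′ ++ (E ∸ 1) ∷ tail′ ↭ upTo (suc E)
  labels′ = begin
      concat cycles′ ++ (map outer (hi 1 ∷ slotTail) ++ map inner path)
    ≡⟨ cong (_++ (map outer (hi 1 ∷ slotTail) ++ map inner path)) (trans (sym (Listₚ.concat-++ (map (map outer) slotCycles) _))
                           (cong₂ _++_ (Listₚ.concat-map slotCycles) (Listₚ.concat-map cycles))) ⟩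
      (map outer (concat slotCycles) ++ map inner (concat cycles)) ++ (map outer (hi 1 ∷ slotTail) ++ map inner path)
    ↭⟨ ++-interchange (map outer (concat slotCycles)) _ _ _ ⟩
      (map outer (concat slotCycles) ++ map outer (hi 1 ∷ slotTail)) ++ (map inner (concat cycles) ++ map inner path)
    ≡⟨ cong₂ _++_ (Listₚ.map-++ outer (concat slotCycles) _) (Listₚ.map-++ inner (concat cycles) path) ⟨
      map outer (concat slotCycles ++ hi 1 ∷ slotTail) ++ map inner (concat cycles ++ path)
    ↭⟨ ↭ₚ.++⁺ (↭ₚ.map⁺ outer slots) (↭ₚ.map⁺ inner labels) ⟩
      map outer (map lo (upTo n) ++ map hi (upTo n)) ++ map inner (upTo (suc ε))
    ≡⟨ cong (_++ map inner (upTo (suc ε))) (trans (Listₚ.map-++ outer (map lo (upTo n)) _)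
                           (cong₂ _++_ (trans (sym (Listₚ.map-∘ (upTo n))) (Listₚ.map-id (upTo n)))
                                       (sym (Listₚ.map-∘ (upTo n))))) ⟩
      (upTo n ++ map (E ∸_) (upTo n)) ++ map inner (upTo (suc ε))
    ↭⟨ collar-labels-↭ n ε ⟩
      upTo (suc E) ∎
    where open PermutationReasoning

  join : map outer (hi 1 ∷ slotTail) ∷ʳ inner (ε ∸ 1) ≡ map outer (hi 1 ∷ slotTail ∷ʳ hi (suc n))
  join = trans (cong (map outer (hi 1 ∷ slotTail) ∷ʳ_) (sym (+-+-∸-suc n ε 1≤ε)))
               (sym (Listₚ.map-++ outer (hi 1 ∷ slotTail) [ hi (suc n) ]))

  pairs′-↭ : graphPairs cycles′ ((E ∸ 1) ∷ tail′)
           ↭ map (both outer) (collarPairs n slotCycles slotTail) ++ map (both inner) (graphPairs cycles path)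
  pairs′-↭ = begin
      concatMap cyclePairs cycles′ ++ pathPairs (map outer (hi 1 ∷ slotTail) ++ map inner path)
    ≡⟨ cong₂ _++_ (trans (Listₚ.concatMap-++ cyclePairs (map (map outer) slotCycles) _)
                         (cong₂ _++_ (concatMap-cyclePairs-map outer slotCycles) (concatMap-cyclePairs-map inner cycles)))
                  (trans (pathPairs-++ (map outer (hi 1 ∷ slotTail)) _ (map inner tail))
                         (cong₂ _++_ (trans (cong pathPairs join) (pathPairs-map outer _)) (pathPairs-map inner path))) ⟩
      (map (both outer) cp ++ map (both inner) ip) ++ (map (both outer) cq ++ map (both inner) iq)
    ↭⟨ ++-interchange (map (both outer) cp) _ _ _ ⟩
      (map (both outer) cp ++ map (both outer) cq) ++ (map (both inner) ip ++ map (both inner) iq)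
    ≡⟨ cong₂ _++_ (Listₚ.map-++ (both outer) cp cq) (Listₚ.map-++ (both inner) ip iq) ⟨
      map (both outer) (collarPairs n slotCycles slotTail) ++ map (both inner) (graphPairs cycles path) ∎
    where
      open PermutationReasoning
      cp cq : List (Slot × Slot)
      cp = concatMap cyclePairs slotCycles
      cq = pathPairs (hi 1 ∷ slotTail ∷ʳ hi (suc n))
      ip iq : List (ℕ × ℕ)
      ip = concatMap cyclePairs cycles
      iq = pathPairs path

  half′ : suc E / 2 ≡ n + suc ε / 2
  half′ = trans (cong (_/ 2) (sym (ℕₚ.+-suc (n + n) ε))) (half-+ n (suc ε))

  lo-low : ∀ {i} → i < n → i < suc E / 2
  lo-low {i} i<n = subst (i <_) (sym half′) (ℕₚ.≤-trans i<n (ℕₚ.m≤m+n n _))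

  hi-high : ∀ {j} → j ≤ suc n → suc E / 2 ≤ E ∸ j
  hi-high {j} j≤ = subst (_≤ E ∸ j) (sym half′)
    (ℕₚ.≤-trans (ℕₚ.+-monoʳ-≤ n (⌈/2⌉≤pred ε 2≤ε)) (subst (_≤ E ∸ j) (+-+-∸-suc n ε 1≤ε) (ℕₚ.∸-monoʳ-≤ E j≤)))

  crossing-straddles : ∀ p → Crosses n p → Straddles (suc E / 2) (both outer p)
  crossing-straddles (lo i , hi j) (i< , j≤) = inj₁ (lo-low i< , hi-high j≤)
  crossing-straddles (hi j , lo i) (i< , j≤) = inj₂ (lo-low i< , hi-high j≤)

  crossing-gap : ∀ p → Crosses n p → gap (both outer p) ≡ E ∸ indexSum p
  crossing-gap (lo i , hi j) (i< , j≤) =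
    trans (ℕₚ.m≤n⇒∣m-n∣≡n∸m (ℕₚ.<⇒≤ (ℕₚ.<-≤-trans (lo-low i<) (hi-high j≤))))
          (trans (ℕₚ.∸-+-assoc E j i) (cong (E ∸_) (ℕₚ.+-comm j i)))
  crossing-gap (hi j , lo i) (i< , j≤) =
    trans (ℕₚ.m≤n⇒∣n-m∣≡n∸m (ℕₚ.<⇒≤ (ℕₚ.<-≤-trans (lo-low i<) (hi-high j≤)))) (ℕₚ.∸-+-assoc E j i)

  inner-straddles : ∀ p → Straddles (suc ε / 2) p → Straddles (suc E / 2) (both inner p)
  inner-straddles (x , y) s = subst (λ a → Straddles a (inner x , inner y)) (sym half′) (shift s)
    where
      shift : ∀ {x y} → Straddles (suc ε / 2) (x , y) → Straddles (n + suc ε / 2) (inner x , inner y)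
      shift (inj₁ (x< , ≤y)) = inj₁ (ℕₚ.+-monoʳ-< n x< , ℕₚ.+-monoʳ-≤ n ≤y)
      shift (inj₂ (y< , ≤x)) = inj₂ (ℕₚ.+-monoʳ-< n y< , ℕₚ.+-monoʳ-≤ n ≤x)

  straddle′ : All (Straddles (suc E / 2)) (graphPairs cycles′ ((E ∸ 1) ∷ tail′))
  straddle′ = ↭ₚ.All-resp-↭ (↭-sym pairs′-↭)
    (Allₚ.++⁺ (Allₚ.map⁺ (All.map (crossing-straddles _) crossing)) (Allₚ.map⁺ (All.map (inner-straddles _) straddle)))

  gaps′ : map gap (graphPairs cycles′ ((E ∸ 1) ∷ tail′)) ↭ map suc (upTo E)
  gaps′ = begin
      map gap (graphPairs cycles′ ((E ∸ 1) ∷ tail′))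
    ↭⟨ ↭ₚ.map⁺ gap pairs′-↭ ⟩
      map gap (map (both outer) cp ++ map (both inner) ip)
    ≡⟨ Listₚ.map-++ gap (map (both outer) cp) _ ⟩
      map gap (map (both outer) cp) ++ map gap (map (both inner) ip)
    ≡⟨ cong₂ _++_ (trans (sym (Listₚ.map-∘ cp)) (trans (Listₚ.map-cong-local (All.map (crossing-gap _) crossing)) (Listₚ.map-∘ cp)))
                  (trans (sym (Listₚ.map-∘ ip)) (Listₚ.map-cong (λ { (x , y) → ℕₚ.∣m+n-m+o∣≡∣n-o∣ n x y }) ip)) ⟩
      map (E ∸_) (map indexSum cp) ++ map gap ip
    ↭⟨ ↭ₚ.++⁺ (↭ₚ.map⁺ (E ∸_) indexSums) gaps ⟩
      map (E ∸_) (upTo (n + n)) ++ map suc (upTo ε)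
    ↭⟨ collar-gaps-↭ n ε ⟩
      map suc (upTo E) ∎
    where
      open PermutationReasoning
      cp : List (Slot × Slot)
      cp = collarPairs n slotCycles slotTail
      ip : List (ℕ × ℕ)
      ip = graphPairs cycles path

  extended : AlphaLists E cycles′ tail′
  extended = record { labels = labels′ ; straddle = straddle′ ; gaps = gaps′ ; 2≤ε = ℕₚ.≤-trans 2≤ε (ℕₚ.m≤n+m ε (n + n)) }

lengths-map : {A : Set} (f : A → ℕ) (xss : List (List A)) → CycleLengths (map (map f) xss) (map length xss)
lengths-map f [] = []
lengths-map f (xs ∷ xss) = Listₚ.length-map f xs ∷ lengths-map f xss

CycleLengths-map : (f : ℕ → ℕ) {cycles : List (List ℕ)} {L : List ℕ} →
  CycleLengths cycles L → CycleLengths (map (map f) cycles) L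
CycleLengths-map f [] = []
CycleLengths-map f {c ∷ _} (e ∷ es) = trans (Listₚ.length-map f c) e ∷ CycleLengths-map f es

sum-map-length : {A : Set} (xss : List (List A)) → sum (map length xss) ≡ length (concat xss)
sum-map-length [] = refl
sum-map-length (xs ∷ xss) = trans (cong (length xs +_) (sum-map-length xss)) (sym (Listₚ.length-++ xs))

Alpha-collar : ∀ {L m} (c : Collar) → Alpha L m →
  Alpha (map length (Collar.cycles c) ++ L) (suc (length (Collar.tail c)) + m)
Alpha-collar {L} {m} c α = record
  { cycles        = cycles′
  ; cycle-lengths = Pointwise.++⁺ (lengths-map outer slotCycles) (CycleLengths-map inner cycle-lengths)
  ; tail          = tail′
  ; tail-length   = trans (Listₚ.length-++ (map outer slotTail))
      (trans (cong₂ _+_ (Listₚ.length-map outer slotTail) (trans (Listₚ.length-map inner path) (cong suc tail-length)))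
             (ℕₚ.+-suc (length slotTail) m))
  ; lists         = subst (λ k → AlphaLists k cycles′ tail′) edgeCount-collar extended
  }
  where
    open Alpha α
    open Collar c using (size; slots) renaming (cycles to slotCycles; tail to slotTail)
    open ExtendByCollar c lists

    slot-count : length (concat slotCycles) + suc (length slotTail) ≡ size + size
    slot-count = begin
        length (concat slotCycles) + suc (length slotTail)
      ≡⟨ Listₚ.length-++ (concat slotCycles) ⟨
        length (concat slotCycles ++ hi 1 ∷ slotTail)
      ≡⟨ ↭ₚ.↭-length slots ⟩
        length (map lo (upTo size) ++ map hi (upTo size))
      ≡⟨ Listₚ.length-++ (map lo (upTo size)) ⟩
        length (map lo (upTo size)) + length (map hi (upTo size))
      ≡⟨ cong₂ _+_ (trans (Listₚ.length-map lo (upTo size)) (Listₚ.length-upTo size))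
                   (trans (Listₚ.length-map hi (upTo size)) (Listₚ.length-upTo size)) ⟩
        size + size ∎
      where open ≡-Reasoning

    edgeCount-collar : size + size + edgeCount L m ≡ edgeCount (map length slotCycles ++ L) (suc (length slotTail) + m)
    edgeCount-collar = begin
        size + size + (sum L + m)
      ≡⟨ cong (_+ (sum L + m)) slot-count ⟨
        length (concat slotCycles) + suc (length slotTail) + (sum L + m)
      ≡⟨ regroup (length (concat slotCycles)) (suc (length slotTail)) (sum L) m ⟩
        (length (concat slotCycles) + sum L) + (suc (length slotTail) + m)
      ≡⟨ cong (λ k → (k + sum L) + (suc (length slotTail) + m)) (sum-map-length slotCycles) ⟨
        (sum (map length slotCycles) + sum L) + (suc (length slotTail) + m)
      ≡⟨ cong (_+ (suc (length slotTail) + m)) (sumₚ.sum-++ (map length slotCycles) L) ⟨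
        sum (map length slotCycles ++ L) + (suc (length slotTail) + m) ∎
      where
        open ≡-Reasoning
        regroup : ∀ a r s m → (a + r) + (s + m) ≡ (a + s) + (r + m)
        regroup = solve-∀

-- Collars around a single cycle

module SlotListSolver = CommutativeMonoidSolver (↭ₚ.++-commutativeMonoid {A = Slot})
module PairListSolver = CommutativeMonoidSolver (↭ₚ.++-commutativeMonoid {A = Slot × Slot})

shift3 : Slot → Slot
shift3 (lo i) = lo (3 + i)
shift3 (hi j) = hi (3 + j)

Crosses-shift3 : ∀ n p → Crosses n p → Crosses (3 + n) (both shift3 p)
Crosses-shift3 n (lo i , hi j) (i< , j≤) = s≤s (s≤s (s≤s i<)) , s≤s (s≤s (s≤s j≤))
Crosses-shift3 n (hi j , lo i) (i< , j≤) = s≤s (s≤s (s≤s i<)) , s≤s (s≤s (s≤s j≤))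

indexSum-shift3 : ∀ p → indexSum (both shift3 p) ≡ 6 + indexSum p
indexSum-shift3 (x , y) = trans (cong₂ _+_ (index-shift3 x) (index-shift3 y)) (regroup (index x) (index y))
  where
    index-shift3 : ∀ z → index (shift3 z) ≡ 3 + index z
    index-shift3 (lo _) = refl
    index-shift3 (hi _) = refl
    regroup : ∀ a b → 3 + a + (3 + b) ≡ 6 + (a + b)
    regroup = solve-∀

map-upTo-3+ : {A : Set} (f : ℕ → A) (n : ℕ) → map f (upTo (3 + n)) ≡ f 0 ∷ f 1 ∷ f 2 ∷ map (f ∘ (3 +_)) (upTo n)
map-upTo-3+ f n = trans (cong (map f) (upTo-+ 3 n)) (cong (λ xs → f 0 ∷ f 1 ∷ f 2 ∷ xs) (sym (Listₚ.map-∘ (upTo n))))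

-- tail-short: the path edges added by the collar of a cycle are paid for by the cycle's own length.
record CycleCollar (ℓ : ℕ) : Set where
  field
    size         : ℕ
    rest         : List Slot
    tail         : List Slot
    1≤size       : 1 ≤ size
    cycle-length : length (hi 0 ∷ lo 0 ∷ rest) ≡ ℓ
    tail-short   : suc (length tail) ≤ ℓ
    slots        : concat [ hi 0 ∷ lo 0 ∷ rest ] ++ hi 1 ∷ tail ↭ map lo (upTo size) ++ map hi (upTo size)
    crossing     : All (Crosses size) (collarPairs size [ hi 0 ∷ lo 0 ∷ rest ] tail)
    indexSums    : map indexSum (collarPairs size [ hi 0 ∷ lo 0 ∷ rest ] tail) ↭ upTo (size + size)

  collar : Collar
  collar = record { size = size ; cycles = [ hi 0 ∷ lo 0 ∷ rest ] ; tail = tail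
                  ; slots = slots ; crossing = crossing ; indexSums = indexSums }

upTo-pred : ∀ {n} → 1 ≤ n → upTo n ≡ 0 ∷ map suc (upTo (n ∸ 1))
upTo-pred {suc n} _ = cong (0 ∷_) (sym (Listₚ.map-upTo suc n))

-- The cycle grows by four: six slots lo 0, lo 1, lo 2, hi 0, hi 1, hi 2 are added below the old
-- (shifted) ones, the old edge hi 0 — lo 0 is replaced by the detour lo 0, hi 2, lo 3, …, hi 3, lo 1,
-- hi 0, and the path gets the prefix hi 1, lo 2, hi 4.  The seven new edges have index sums 0, …, 6,
-- and the remaining old ones move up by 6.
module GrowCycleCollar {ℓ : ℕ} (κ : CycleCollar ℓ) where
  open CycleCollar κ

  n′ : ℕ
  n′ = 3 + size

  rest′ : List Slot
  rest′ = hi 2 ∷ lo 3 ∷ map shift3 rest ++ hi 3 ∷ lo 1 ∷ []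

  tail′ : List Slot
  tail′ = lo 2 ∷ hi 4 ∷ map shift3 tail

  newSlots : List Slot
  newSlots = lo 0 ∷ lo 1 ∷ lo 2 ∷ hi 0 ∷ hi 1 ∷ hi 2 ∷ []

  newPairs : List (Slot × Slot)
  newPairs = (hi 0 , lo 0) ∷ (lo 0 , hi 2) ∷ (hi 2 , lo 3) ∷ (hi 3 , lo 1) ∷ (lo 1 , hi 0) ∷ (hi 1 , lo 2) ∷ (lo 2 , hi 4) ∷ []

  slots′-split : concat [ hi 0 ∷ lo 0 ∷ rest′ ] ++ hi 1 ∷ tail′ ↭ newSlots ++ map shift3 (concat [ hi 0 ∷ lo 0 ∷ rest ] ++ hi 1 ∷ tail)
  slots′-split = ↭-trans
    (solve 10 (λ h0 l0 h2 l3 m h3 l1 h1 l2 t →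
                 ((h0 ⊕ l0 ⊕ h2 ⊕ l3 ⊕ (m ⊕ h3 ⊕ l1)) ⊕ ∅) ⊕ h1 ⊕ l2 ⊕ t
               ⊜ (l0 ⊕ l1 ⊕ l2 ⊕ h0 ⊕ h1 ⊕ h2) ⊕ (h3 ⊕ l3 ⊕ (m ⊕ t))) ↭-refl
       [ hi 0 ] [ lo 0 ] [ hi 2 ] [ lo 3 ] (map shift3 rest) [ hi 3 ] [ lo 1 ] [ hi 1 ] [ lo 2 ] (hi 4 ∷ map shift3 tail))
    (↭-reflexive (cong (λ xs → newSlots ++ hi 3 ∷ lo 3 ∷ xs) (sym (begin
        map shift3 ((rest ++ []) ++ hi 1 ∷ tail)  ≡⟨ cong (λ xs → map shift3 (xs ++ hi 1 ∷ tail)) (Listₚ.++-identityʳ rest) ⟩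
        map shift3 (rest ++ hi 1 ∷ tail)         ≡⟨ Listₚ.map-++ shift3 rest (hi 1 ∷ tail) ⟩
        map shift3 rest ++ hi 4 ∷ map shift3 tail ∎))))
    where
      open SlotListSolver using (solve; _⊕_; _⊜_) renaming (id to ∅)
      open ≡-Reasoning

  range′-split : map lo (upTo n′) ++ map hi (upTo n′) ↭ newSlots ++ map shift3 (map lo (upTo size) ++ map hi (upTo size))
  range′-split = begin
      map lo (upTo n′) ++ map hi (upTo n′)
    ≡⟨ cong₂ _++_ (trans (map-upTo-3+ lo size) (cong (λ xs → lo 0 ∷ lo 1 ∷ lo 2 ∷ xs) (Listₚ.map-∘ (upTo size))))
                  (trans (map-upTo-3+ hi size) (cong (λ xs → hi 0 ∷ hi 1 ∷ hi 2 ∷ xs) (Listₚ.map-∘ (upTo size)))) ⟩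
      (lo 0 ∷ lo 1 ∷ lo 2 ∷ map shift3 los) ++ (hi 0 ∷ hi 1 ∷ hi 2 ∷ map shift3 his)
    ↭⟨ solve 8 (λ l0 l1 l2 h0 h1 h2 a b → (l0 ⊕ l1 ⊕ l2 ⊕ a) ⊕ (h0 ⊕ h1 ⊕ h2 ⊕ b) ⊜ (l0 ⊕ l1 ⊕ l2 ⊕ h0 ⊕ h1 ⊕ h2) ⊕ (a ⊕ b)) ↭-refl
         [ lo 0 ] [ lo 1 ] [ lo 2 ] [ hi 0 ] [ hi 1 ] [ hi 2 ] (map shift3 los) (map shift3 his) ⟩
      newSlots ++ (map shift3 los ++ map shift3 his)
    ≡⟨ cong (newSlots ++_) (Listₚ.map-++ shift3 los his) ⟨
      newSlots ++ map shift3 (los ++ his) ∎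
    where
      open PermutationReasoning
      open SlotListSolver using (solve; _⊕_; _⊜_)
      los his : List Slot
      los = map lo (upTo size)
      his = map hi (upTo size)

  slots′ : concat [ hi 0 ∷ lo 0 ∷ rest′ ] ++ hi 1 ∷ tail′ ↭ map lo (upTo n′) ++ map hi (upTo n′)
  slots′ = ↭-trans slots′-split (↭-trans (↭ₚ.++⁺ˡ newSlots (↭ₚ.map⁺ shift3 slots)) (↭-sym range′-split))

  oldCycle oldPath : List (Slot × Slot)
  oldCycle = pathPairs (lo 0 ∷ rest ∷ʳ hi 0)
  oldPath = pathPairs (hi 1 ∷ tail ∷ʳ hi (suc size))

  pairs-split : collarPairs size [ hi 0 ∷ lo 0 ∷ rest ] tail ≡ (hi 0 , lo 0) ∷ oldCycle ++ oldPath
  pairs-split = cong (_++ oldPath) (Listₚ.++-identityʳ ((hi 0 , lo 0) ∷ oldCycle))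

  detour : pathPairs (lo 3 ∷ (map shift3 rest ++ hi 3 ∷ lo 1 ∷ []) ∷ʳ hi 0)
         ≡ map (both shift3) oldCycle ++ (hi 3 , lo 1) ∷ (lo 1 , hi 0) ∷ []
  detour = begin
      pathPairs (lo 3 ∷ (map shift3 rest ++ hi 3 ∷ lo 1 ∷ []) ∷ʳ hi 0)
    ≡⟨ cong (pathPairs ∘ (lo 3 ∷_)) (Listₚ.++-assoc (map shift3 rest) (hi 3 ∷ lo 1 ∷ []) [ hi 0 ]) ⟩
      pathPairs ((lo 3 ∷ map shift3 rest) ++ hi 3 ∷ lo 1 ∷ hi 0 ∷ [])
    ≡⟨ pathPairs-++ (lo 3 ∷ map shift3 rest) (hi 3) (lo 1 ∷ hi 0 ∷ []) ⟩
      pathPairs (lo 3 ∷ map shift3 rest ∷ʳ hi 3) ++ (hi 3 , lo 1) ∷ (lo 1 , hi 0) ∷ []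
    ≡⟨ cong (λ xs → pathPairs (lo 3 ∷ xs) ++ (hi 3 , lo 1) ∷ (lo 1 , hi 0) ∷ []) (Listₚ.map-++ shift3 rest [ hi 0 ]) ⟨
      pathPairs (map shift3 (lo 0 ∷ rest ∷ʳ hi 0)) ++ (hi 3 , lo 1) ∷ (lo 1 , hi 0) ∷ []
    ≡⟨ cong (_++ (hi 3 , lo 1) ∷ (lo 1 , hi 0) ∷ []) (pathPairs-map shift3 (lo 0 ∷ rest ∷ʳ hi 0)) ⟩
      map (both shift3) oldCycle ++ (hi 3 , lo 1) ∷ (lo 1 , hi 0) ∷ [] ∎
    where open ≡-Reasoning

  shiftedPath : pathPairs (hi 4 ∷ map shift3 tail ∷ʳ hi (suc n′)) ≡ map (both shift3) oldPath
  shiftedPath = trans (cong (pathPairs ∘ (hi 4 ∷_)) (sym (Listₚ.map-++ shift3 tail [ hi (suc size) ])))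
                      (pathPairs-map shift3 (hi 1 ∷ tail ∷ʳ hi (suc size)))

  pairs′-split : collarPairs n′ [ hi 0 ∷ lo 0 ∷ rest′ ] tail′ ↭ newPairs ++ map (both shift3) (oldCycle ++ oldPath)
  pairs′-split = begin
      collarPairs n′ [ hi 0 ∷ lo 0 ∷ rest′ ] tail′
    ≡⟨ cong₂ (λ xs ys → (((hi 0 , lo 0) ∷ (lo 0 , hi 2) ∷ (hi 2 , lo 3) ∷ xs) ++ []) ++ (hi 1 , lo 2) ∷ (lo 2 , hi 4) ∷ ys)
             detour shiftedPath ⟩
      (((hi 0 , lo 0) ∷ (lo 0 , hi 2) ∷ (hi 2 , lo 3) ∷ (sc ++ (hi 3 , lo 1) ∷ (lo 1 , hi 0) ∷ [])) ++ [])
        ++ (hi 1 , lo 2) ∷ (lo 2 , hi 4) ∷ sp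
    ↭⟨ solve 9 (λ a b c s d e f g t → ((a ⊕ b ⊕ c ⊕ (s ⊕ d ⊕ e)) ⊕ ∅) ⊕ f ⊕ g ⊕ t ⊜ (a ⊕ b ⊕ c ⊕ d ⊕ e ⊕ f ⊕ g) ⊕ (s ⊕ t)) ↭-refl
         [ (hi 0 , lo 0) ] [ (lo 0 , hi 2) ] [ (hi 2 , lo 3) ] sc [ (hi 3 , lo 1) ] [ (lo 1 , hi 0) ]
         [ (hi 1 , lo 2) ] [ (lo 2 , hi 4) ] sp ⟩
      newPairs ++ (sc ++ sp)
    ≡⟨ cong (newPairs ++_) (Listₚ.map-++ (both shift3) oldCycle oldPath) ⟨
      newPairs ++ map (both shift3) (oldCycle ++ oldPath) ∎
    where
      open PermutationReasoning
      open PairListSolver using (solve; _⊕_; _⊜_) renaming (id to ∅)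
      sc sp : List (Slot × Slot)
      sc = map (both shift3) oldCycle
      sp = map (both shift3) oldPath

  newPairs-cross : All (Crosses n′) newPairs
  newPairs-cross = (s≤s z≤n , z≤n) ∷ (s≤s z≤n , s≤s (s≤s z≤n)) ∷ (s≤s (s≤s (s≤s 1≤size)) , s≤s (s≤s z≤n))
                 ∷ (s≤s (s≤s z≤n) , s≤s (s≤s (s≤s z≤n))) ∷ (s≤s (s≤s z≤n) , z≤n) ∷ (s≤s (s≤s (s≤s z≤n)) , s≤s z≤n)
                 ∷ (s≤s (s≤s (s≤s z≤n)) , s≤s (s≤s (s≤s (s≤s z≤n)))) ∷ []

  crossing′ : All (Crosses n′) (collarPairs n′ [ hi 0 ∷ lo 0 ∷ rest′ ] tail′)
  crossing′ = ↭ₚ.All-resp-↭ (↭-sym pairs′-split)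
    (Allₚ.++⁺ newPairs-cross (Allₚ.map⁺ (All.map (Crosses-shift3 size _) (All.tail (subst (All (Crosses size)) pairs-split crossing)))))

  oldSums : map indexSum (oldCycle ++ oldPath) ↭ map suc (upTo (size + size ∸ 1))
  oldSums = ↭ₚ.drop-∷ (↭-trans (↭-reflexive (cong (map indexSum) (sym pairs-split)))
                               (↭-trans indexSums (↭-reflexive (upTo-pred (ℕₚ.≤-trans 1≤size (ℕₚ.m≤m+n size size))))))

  size′+size′ : n′ + n′ ≡ 7 + (size + size ∸ 1)
  size′+size′ = lemma 1≤size
    where
      lemma : ∀ {k} → 1 ≤ k → 3 + k + (3 + k) ≡ 7 + (k + k ∸ 1)
      lemma {suc k} _ = rearrange k
        where
          rearrange : ∀ k → 3 + suc k + (3 + suc k) ≡ 7 + (k + suc k)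
          rearrange = solve-∀

  indexSums′ : map indexSum (collarPairs n′ [ hi 0 ∷ lo 0 ∷ rest′ ] tail′) ↭ upTo (n′ + n′)
  indexSums′ = begin
      map indexSum (collarPairs n′ [ hi 0 ∷ lo 0 ∷ rest′ ] tail′)
    ↭⟨ ↭ₚ.map⁺ indexSum pairs′-split ⟩
      map indexSum (newPairs ++ map (both shift3) (oldCycle ++ oldPath))
    ≡⟨ Listₚ.map-++ indexSum newPairs _ ⟩
      map indexSum newPairs ++ map indexSum (map (both shift3) (oldCycle ++ oldPath))
    ≡⟨ cong (map indexSum newPairs ++_)
            (trans (sym (Listₚ.map-∘ (oldCycle ++ oldPath)))
                   (trans (Listₚ.map-cong indexSum-shift3 (oldCycle ++ oldPath)) (Listₚ.map-∘ (oldCycle ++ oldPath)))) ⟩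
      map indexSum newPairs ++ map (6 +_) (map indexSum (oldCycle ++ oldPath))
    ↭⟨ ↭ₚ.++⁺ (to-witness-T (ℕ-Permutation.permutation? (map indexSum newPairs) (upTo 7)) tt) (↭ₚ.map⁺ (6 +_) oldSums) ⟩
      upTo 7 ++ map (6 +_) (map suc (upTo (size + size ∸ 1)))
    ≡⟨ cong (upTo 7 ++_) (Listₚ.map-∘ (upTo (size + size ∸ 1))) ⟨
      upTo 7 ++ map (7 +_) (upTo (size + size ∸ 1))
    ≡⟨ trans (cong upTo size′+size′) (upTo-+ 7 (size + size ∸ 1)) ⟨
      upTo (n′ + n′) ∎
    where open PermutationReasoning

  grown : CycleCollar (4 + ℓ)
  grown = record
    { size = n′ ; rest = rest′ ; tail = tail′ ; 1≤size = s≤s z≤n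
    ; cycle-length = cong (4 +_) (trans (Listₚ.length-++ (map shift3 rest))
        (trans (cong (_+ 2) (Listₚ.length-map shift3 rest)) (trans (ℕₚ.+-comm (length rest) 2) cycle-length)))
    ; tail-short = subst (_≤ 4 + ℓ) (cong (3 +_) (sym (Listₚ.length-map shift3 tail)))
        (ℕₚ.≤-trans (s≤s (s≤s tail-short)) (ℕₚ.m≤n+m (2 + ℓ) 2))
    ; slots = slots′ ; crossing = crossing′ ; indexSums = indexSums′
    }

crosses? : ∀ n p → Dec (Crosses n p)
crosses? n (lo i , hi j) = (suc i ℕ.≤? n) ×-dec (j ℕ.≤? suc n)
crosses? n (hi j , lo i) = (suc i ℕ.≤? n) ×-dec (j ℕ.≤? suc n)
crosses? n (lo _ , lo _) = no λ ()
crosses? n (hi _ , hi _) = no λ ()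

straddles? : ∀ a p → Dec (Straddles a p)
straddles? a (x , y) = ((suc x ℕ.≤? a) ×-dec (a ℕ.≤? y)) ⊎-dec ((suc y ℕ.≤? a) ×-dec (a ℕ.≤? x))

cycleCollar₄ : CycleCollar 4
cycleCollar₄ = record
  { size = 4 ; rest = hi 2 ∷ lo 1 ∷ [] ; tail = lo 3 ∷ hi 3 ∷ lo 2 ∷ []
  ; 1≤size = s≤s z≤n ; cycle-length = refl ; tail-short = s≤s (s≤s (s≤s (s≤s z≤n)))
  ; slots = to-witness-T (Slot-Permutation.permutation? _ _) tt
  ; crossing = toWitness {a? = All.all? (crosses? 4) _} tt
  ; indexSums = to-witness-T (ℕ-Permutation.permutation? _ _) tt
  }

cycleCollar₆ : CycleCollar 6
cycleCollar₆ = record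
  { size = 4 ; rest = hi 2 ∷ lo 3 ∷ hi 3 ∷ lo 1 ∷ [] ; tail = lo 2 ∷ []
  ; 1≤size = s≤s z≤n ; cycle-length = refl ; tail-short = s≤s (s≤s z≤n)
  ; slots = to-witness-T (Slot-Permutation.permutation? _ _) tt
  ; crossing = toWitness {a? = All.all? (crosses? 4) _} tt
  ; indexSums = to-witness-T (ℕ-Permutation.permutation? _ _) tt
  }

cycleCollar : ∀ ℓ → 2 ∣ ℓ → 2 < ℓ → CycleCollar ℓ
cycleCollar 0 _ ()
cycleCollar 1 _ (s≤s ())
cycleCollar 2 _ (s≤s (s≤s ()))
cycleCollar 3 2∣3 _ = ⊥-elim (toWitnessFalse {a? = 2 ∣? 3} tt 2∣3)
cycleCollar 4 _ _ = cycleCollar₄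
cycleCollar 5 2∣5 _ = ⊥-elim (toWitnessFalse {a? = 2 ∣? 5} tt 2∣5)
cycleCollar 6 _ _ = cycleCollar₆
cycleCollar (suc (suc (suc (suc ℓ@(suc (suc (suc _))))))) 2∣4+ℓ _ =
  GrowCycleCollar.grown (cycleCollar ℓ (∣m+n∣m⇒∣n 2∣4+ℓ (divides 2 refl)) (s≤s (s≤s (s≤s z≤n))))

Alpha-cycle : ∀ {ℓ L m} (κ : CycleCollar ℓ) → Alpha L m → Alpha (ℓ ∷ L) (suc (length (CycleCollar.tail κ)) + m)
Alpha-cycle {L = L} {m} κ α =
  subst (λ ℓ → Alpha (ℓ ∷ L) (suc (length (CycleCollar.tail κ)) + m)) (CycleCollar.cycle-length κ)
        (Alpha-collar (CycleCollar.collar κ) α)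

pathCollar : Collar
pathCollar = record
  { size = 2 ; cycles = [] ; tail = lo 1 ∷ hi 0 ∷ lo 0 ∷ []
  ; slots = to-witness-T (Slot-Permutation.permutation? _ _) tt
  ; crossing = toWitness {a? = All.all? (crosses? 2) _} tt
  ; indexSums = to-witness-T (ℕ-Permutation.permutation? _ _) tt
  }

-- Paths and the theorem

searchedPath : ∀ m (tail : List ℕ) → length tail ≡ m → 2 ≤ m →
  T (is-just (ℕ-Permutation.permutation? ((m ∸ 1) ∷ tail) (upTo (suc m)))) →
  True (All.all? (straddles? (suc m / 2)) (pathPairs ((m ∸ 1) ∷ tail))) →
  T (is-just (ℕ-Permutation.permutation? (map gap (pathPairs ((m ∸ 1) ∷ tail))) (map suc (upTo m)))) →
  Alpha [] m
searchedPath m tail tail-length 2≤m labels straddle gaps = record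
  { cycles = [] ; cycle-lengths = [] ; tail = tail ; tail-length = tail-length
  ; lists = record
    { labels   = to-witness-T (ℕ-Permutation.permutation? _ _) labels
    ; straddle = toWitness straddle
    ; gaps     = to-witness-T (ℕ-Permutation.permutation? _ _) gaps
    ; 2≤ε      = 2≤m
    }
  }

pathAlpha : ∀ k → Alpha [] (5 + k)
pathAlpha 0 = searchedPath 5 (0 ∷ 5 ∷ 2 ∷ 3 ∷ 1 ∷ []) refl (s≤s (s≤s z≤n)) tt tt tt
pathAlpha 1 = Alpha-collar pathCollar (searchedPath 2 (0 ∷ 2 ∷ []) refl (s≤s (s≤s z≤n)) tt tt tt)
pathAlpha 2 = Alpha-collar pathCollar (searchedPath 3 (1 ∷ 3 ∷ 0 ∷ []) refl (s≤s (s≤s z≤n)) tt tt tt)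
pathAlpha 3 = searchedPath 8 (0 ∷ 8 ∷ 2 ∷ 4 ∷ 3 ∷ 6 ∷ 1 ∷ 5 ∷ []) refl (s≤s (s≤s z≤n)) tt tt tt
pathAlpha (suc (suc (suc (suc k)))) = Alpha-collar pathCollar (pathAlpha k)

attachCycles : ∀ L → All (λ ℓ → (2 ∣ ℓ) × (2 < ℓ)) L →
  Σ ℕ λ s → s ≤ sum L × (∀ {m} → Alpha [] m → Alpha L (s + m))
attachCycles [] [] = 0 , z≤n , λ α → α
attachCycles (ℓ ∷ L) ((2∣ℓ , 2<ℓ) ∷ even) with attachCycles L even | cycleCollar ℓ 2∣ℓ 2<ℓ
... | s , s≤ΣL , attach | κ = t + s , ℕₚ.+-mono-≤ (CycleCollar.tail-short κ) s≤ΣL ,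
      λ {m} α → subst (Alpha (ℓ ∷ L)) (sym (ℕₚ.+-assoc t s m)) (Alpha-cycle κ (attach α))
  where
    t : ℕ
    t = suc (length (CycleCollar.tail κ))

sum≤length*maxL : ∀ L → sum L ≤ length L * maxL L
sum≤length*maxL [] = z≤n
sum≤length*maxL (ℓ ∷ L) = ℕₚ.+-mono-≤ (ℕₚ.m≤m⊔n ℓ (maxL L))
  (ℕₚ.≤-trans (sum≤length*maxL L) (ℕₚ.*-monoʳ-≤ (length L) (ℕₚ.m≤n⊔m ℓ (maxL L))))

*+5≤bound : ∀ a b → a * b + 5 ≤ 2 * (a + 1) * (b + 1) + 3
*+5≤bound a b = subst (a * b + 5 ≤_) (sym (expand a b)) (ℕₚ.m≤m+n (a * b + 5) (a * b + 2 * a + 2 * b))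
  where
    expand : ∀ a b → 2 * (a + 1) * (b + 1) + 3 ≡ (a * b + 5) + (a * b + 2 * a + 2 * b)
    expand = solve-∀

corollary4p9 : (L : List ℕ) → All (λ ℓ → (2 ∣ ℓ) × (2 < ℓ)) L →
    (m : ℕ) → 2 * (length L + 1) * (maxL L + 1) + 3 ≤ m →
    Σ (Vertex L m → ℤ) (IsAlphaLabeling L m)
corollary4p9 L even m bound with attachCycles L even
... | s , s≤ΣL , attach = isAlphaLabeling (subst (Alpha L) s+[5+k]≡m (attach (pathAlpha k)))
  where
    s+5≤m : s + 5 ≤ m
    s+5≤m = ℕₚ.≤-trans (ℕₚ.+-monoˡ-≤ 5 (ℕₚ.≤-trans s≤ΣL (sum≤length*maxL L)))
                       (ℕₚ.≤-trans (*+5≤bound (length L) (maxL L)) bound)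
    k : ℕ
    k = m ∸ (s + 5)
    s+[5+k]≡m : s + (5 + k) ≡ m
    s+[5+k]≡m = trans (sym (ℕₚ.+-assoc s 5 k)) (ℕₚ.m+[n∸m]≡n s+5≤m)
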